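{- Let $q$ be a prime power with $p = \mathrm{char}(\mathbb F_q)$, let $k \ge 2$, $n$, $h$ be integers, let $F$ be a monic polynomial of degree $n$ in $\mathbb F_q[x]$, and let $d$ be an integer with $h < d \le n/k$. Let $r$ be the least positive integer such that $p \nmid \binom{k}{r}$. Suppose $G, H \in \mathcal S_q(d)$ with $G \ne H$. If $r < k$, then \[ \deg(G-H) \ge \frac{(k+r)d - n}{r}. \] If $r = k$, then either $\deg(G-H) \ge \frac{2kd-n}{k}$, or \[ \deg(G-H) \le \frac{h + kd - n}{k}. \]
   Context: $\mathbb F_q$ is the finite field with $q$ elements and $\mathcal M_q$ the set of monic polynomials in $\mathbb F_q[x]$; $\mathcal M_q(d)$ is the set of monic polynomials of degree $d$. For $F \in \mathbb F_q[x]$ and an integer $h$, $\mathcal I_q(F,h) = \{ Q \in \mathbb F_q[x] : \deg(F-Q) \le h\}$. With $F, h, k$ fixed, $\mathcal S_q(d) = \{ G \in \mathcal M_q(d) : G^k A \in \mathcal I_q(F,h) \text{ for some } A \in \mathcal M_q\}$. -}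

module Defs where

open import Level using (0ℓ)
open import Algebra.Bundles using (CommutativeRing)
open import Data.Nat as ℕ using (ℕ; zero; suc)
open import Data.Integer as ℤ using (ℤ; +_)
open import Data.Fin using (Fin)
open import Data.List using (List; []; _∷_)
open import Data.Product using (Σ; ∃; _×_; _,_)
open import Relation.Nullary using (¬_; Dec)
open import Relation.Binary.PropositionalEquality as ≡ using (_≡_)
open import Function.Bundles using (Bijection)

record FiniteField (q : ℕ) : Set₁ where
  field
    cring     : CommutativeRing 0ℓ 0ℓ
  open CommutativeRing cring public
  field
    1≉0       : ¬ (1# ≈ 0#)
    inverse   : ∀ x → ¬ (x ≈ 0#) → Σ Carrier (λ y → x * y ≈ 1#)
    _≟_       : ∀ x y → Dec (x ≈ y)
    card      : Bijection setoid (≡.setoid (Fin q))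

module Poly {q : ℕ} (𝔽 : FiniteField q) where
  open FiniteField 𝔽 public

  _·1 : ℕ → Carrier
  zero ·1 = 0#
  suc n ·1 = 1# + (n ·1)

  -- Polynomials in F_q[x] as coefficient lists, constant term first.
  Pol : Set
  Pol = List Carrier

  coeff : Pol → ℕ → Carrier
  coeff []       _       = 0#
  coeff (a ∷ _)  zero    = a
  coeff (_ ∷ as) (suc i) = coeff as i

  _⊕_ : Pol → Pol → Pol
  []       ⊕ bs       = bs
  (a ∷ as) ⊕ []       = a ∷ as
  (a ∷ as) ⊕ (b ∷ bs) = (a + b) ∷ (as ⊕ bs)

  scale : Carrier → Pol → Pol
  scale c []       = []
  scale c (b ∷ bs) = (c * b) ∷ scale c bs

  neg : Pol → Pol
  neg []       = []
  neg (a ∷ as) = (- a) ∷ neg as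

  _⊖_ : Pol → Pol → Pol
  P ⊖ Q = P ⊕ neg Q

  _⊗_ : Pol → Pol → Pol
  []       ⊗ Q = []
  (a ∷ as) ⊗ Q = scale a Q ⊕ (0# ∷ (as ⊗ Q))

  one : Pol
  one = 1# ∷ []

  _^^_ : Pol → ℕ → Pol
  P ^^ zero  = one
  P ^^ suc n = P ⊗ (P ^^ n)

  _≋_ : Pol → Pol → Set
  P ≋ Q = ∀ i → coeff P i ≈ coeff Q i

  -- deg P = D  (only for nonzero P; the zero polynomial has no HasDeg)
  HasDeg : Pol → ℕ → Set
  HasDeg P D = ¬ (coeff P D ≈ 0#) × (∀ i → D ℕ.< i → coeff P i ≈ 0#)

  -- deg P ≤ m for an integer m (the zero polynomial, of degree -∞,
  -- satisfies this for every m)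
  DegLe : Pol → ℤ → Set
  DegLe P m = ∀ i → m ℤ.< + i → coeff P i ≈ 0#

  MonicDeg : Pol → ℕ → Set
  MonicDeg P d = HasDeg P d × coeff P d ≈ 1#

  Monic : Pol → Set
  Monic P = ∃ λ e → MonicDeg P e

  InI : Pol → ℤ → Pol → Set
  InI F h Q = DegLe (F ⊖ Q) h

  InS : Pol → ℤ → ℕ → ℕ → Pol → Set
  InS F h k d G = MonicDeg G d × (∃ λ A → Monic A × InI F h ((G ^^ k) ⊗ A))

-- Write G = H + E with E = G - H, of degree D < d and leading coefficient ε. By the binomial
-- theorem G^k - H^k = Σ_{s ≥ 1} C(k,s) E^s H^(k-s). In characteristic p the terms with s < r
-- vanish, and of the remaining ones the term s = r has the largest degree rD + (k-r)d, with
-- leading coefficient C(k,r) ε^r ≠ 0. Since G^k A and H^k B both agree with F above degree h,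
-- the cofactor A has degree a = n - kd and H^k (A - B) + (G^k - H^k) A has degree at most h.
-- So either A = B and rD + (k-r)d + a ≤ h, or the two summands have the same degree
-- kd + deg (A - B) = rD + (k-r)d + a; both bounds follow by arithmetic.

module Submission where

open import Defs
open import Algebra.Bundles using (CommutativeRing; CommutativeSemiring)
open import Data.Empty using (⊥-elim)
open import Data.Fin as Fin using (Fin; toℕ; fromℕ<)
import Data.Fin.Properties as Fin
open import Data.Integer as ℤ using (ℤ; +_)
import Data.Integer.Properties as ℤ
open import Data.List using ([]; _∷_)
open import Data.Nat as ℕ using (ℕ; zero; suc; z≤n; s≤s)
import Data.Nat.Properties as ℕ
open import Data.Nat.Combinatorics using (_C_; k>n⇒nCk≡0)
open import Data.Nat.Coprimality using (Coprime; coprime-Bézout)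
open import Data.Nat.Divisibility using (_∣_; divides; _∣0)
open import Data.Nat.GCD using (module Bézout)
open import Data.Nat.Primality using (Prime; prime⇒irreducible)
open import Data.Product using (_,_; ∃; proj₁)
open import Data.Sum using (_⊎_; inj₁; inj₂)
open import Function using (_∘_; case_of_)
open import Relation.Binary.Definitions using (tri<; tri≈; tri>)
open import Relation.Binary.PropositionalEquality as ≡ using (_≡_; _≢_)
open import Relation.Nullary using (¬_; yes; no)

module Arithmetic where
  open import Data.Nat.Base using (_+_; _*_; _∸_; _≤_; _<_)
  open import Data.Nat.Solver using () renaming (module +-*-Solver to ℕ-Solver)
  open import Data.Integer.Solver using () renaming (module +-*-Solver to ℤ-Solver)

  binomial-degree-decreasing : ∀ {D d r s k} → D < d → r < s → s ≤ k →
    s * D + (k ∸ s) * d < r * D + (k ∸ r) * d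
  binomial-degree-decreasing {D} {d} {r} D<d r<s s≤k
    with t , ≡.refl ← ℕ.m≤n⇒∃[o]m+o≡n r<s | u , ≡.refl ← ℕ.m≤n⇒∃[o]m+o≡n s≤k = begin-strict
    (suc r + t) * D + (suc r + t + u ∸ (suc r + t)) * d
      ≡⟨ ≡.cong (λ x → (suc r + t) * D + x * d) (ℕ.m+n∸m≡n (suc r + t) u) ⟩
    (suc r + t) * D + u * d
      ≡⟨ solve 5 (λ r t u D d → (con 1 :+ r :+ t) :* D :+ u :* d := r :* D :+ ((con 1 :+ t) :* D :+ u :* d))
                 ≡.refl r t u D d ⟩
    r * D + (suc t * D + u * d)
      <⟨ ℕ.+-monoʳ-< (r * D) (ℕ.+-monoˡ-< (u * d) (ℕ.*-monoʳ-< (suc t) D<d)) ⟩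
    r * D + (suc t * d + u * d)
      ≡⟨ ≡.cong (λ x → r * D + x) (ℕ.*-distribʳ-+ d (suc t) u) ⟨
    r * D + (suc t + u) * d
      ≡⟨ ≡.cong (λ x → r * D + x * d) k∸r≡1+t+u ⟨
    r * D + (suc r + t + u ∸ r) * d ∎
    where
    open ℕ.≤-Reasoning
    open ℕ-Solver
    k∸r≡1+t+u : suc r + t + u ∸ r ≡ suc t + u
    k∸r≡1+t+u = ≡.trans
      (≡.cong (_∸ r) (≡.trans (≡.cong suc (ℕ.+-assoc r t u)) (≡.sym (ℕ.+-suc r (t + u)))))
      (ℕ.m+n∸m≡n r (suc t + u))

  ≤+⇒-≤ : ∀ {x y z} → x ≤ y + z → + x ℤ.- + y ℤ.≤ + z
  ≤+⇒-≤ {x} {y} {z} x≤y+z = begin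
    + x ℤ.- + y         ≡⟨ ℤ.[+m]-[+n]≡m⊖n x y ⟩
    x ℤ.⊖ y             ≤⟨ ℤ.⊖-monoˡ-≤ y x≤y+z ⟩
    (y + z) ℤ.⊖ y       ≡⟨ ℤ.⊖-≥ (ℕ.m≤m+n y z) ⟩
    + (y + z ∸ y)       ≡⟨ ≡.cong +_ (ℕ.m+n∸m≡n y z) ⟩
    + z                 ∎
    where open ℤ.≤-Reasoning

  cancel-common : ∀ {k d D r a} → r ≤ k → k * d ≤ r * D + (k ∸ r) * d + a → r * d ≤ r * D + a
  cancel-common {k} {d} {D} {r} {a} r≤k kd≤W+a = ℕ.+-cancelʳ-≤ ((k ∸ r) * d) (r * d) (r * D + a) (begin
    r * d + (k ∸ r) * d       ≡⟨ ℕ.*-distribʳ-+ d r (k ∸ r) ⟨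
    (r + (k ∸ r)) * d         ≡⟨ ≡.cong (_* d) (ℕ.m+[n∸m]≡n r≤k) ⟩
    k * d                     ≤⟨ kd≤W+a ⟩
    r * D + (k ∸ r) * d + a
      ≡⟨ solve 3 (λ x y z → x :+ y :+ z := x :+ z :+ y) ≡.refl (r * D) ((k ∸ r) * d) a ⟩
    r * D + a + (k ∸ r) * d   ∎)
    where
    open ℕ.≤-Reasoning
    open ℕ-Solver

  +≤⇒≤-+ : ∀ {x y a} {h : ℤ} → + (x + a) ℤ.≤ h → + x ℤ.≤ h ℤ.+ + y ℤ.- + (y + a)
  +≤⇒≤-+ {x} {y} {a} {h} x+a≤h = begin
    + x                               ≡⟨ solve 2 (λ x a → x := x :+ a :- a) ≡.refl (+ x) (+ a) ⟩
    + x ℤ.+ + a ℤ.- + a               ≡⟨ ≡.cong (ℤ._- + a) (ℤ.pos-+ x a) ⟨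
    + (x + a) ℤ.- + a                 ≤⟨ ℤ.+-monoˡ-≤ (ℤ.- + a) x+a≤h ⟩
    h ℤ.- + a                         ≡⟨ solve 3 (λ h y a → h :- a := h :+ y :- (y :+ a)) ≡.refl h (+ y) (+ a) ⟩
    h ℤ.+ + y ℤ.- (+ y ℤ.+ + a)       ≡⟨ ≡.cong (λ z → h ℤ.+ + y ℤ.- z) (ℤ.pos-+ y a) ⟨
    h ℤ.+ + y ℤ.- + (y + a)           ∎
    where
    open ℤ.≤-Reasoning
    open ℤ-Solver

  module _ {k n d D a : ℕ} {h : ℤ} (h<d : h ℤ.< + d) (kd+a≡n : k * d + a ≡ n) where

    bound-from-degrees : ∀ {r} → r ≤ k → k * d ≤ r * D + (k ∸ r) * d + a →
                         + ((k + r) * d) ℤ.- + n ℤ.≤ + (r * D)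
    bound-from-degrees {r} r≤k kd≤W+a = ≤+⇒-≤ (begin
      (k + r) * d           ≡⟨ ℕ.*-distribʳ-+ d k r ⟩
      k * d + r * d         ≤⟨ ℕ.+-monoʳ-≤ (k * d) (cancel-common r≤k kd≤W+a) ⟩
      k * d + (r * D + a)   ≡⟨ solve 3 (λ x y z → x :+ (y :+ z) := x :+ z :+ y) ≡.refl (k * d) (r * D) a ⟩
      k * d + a + r * D     ≡⟨ ≡.cong (_+ r * D) kd+a≡n ⟩
      n + r * D             ∎)
      where
      open ℕ.≤-Reasoning
      open ℕ-Solver

    bound-if-r<k : ∀ {r} → r < k →
                   + (r * D + (k ∸ r) * d + a) ℤ.≤ h ⊎ k * d ≤ r * D + (k ∸ r) * d + a →
                   + ((k + r) * d) ℤ.- + n ℤ.≤ + (r * D)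
    bound-if-r<k {r} r<k (inj₁ W+a≤h) = ⊥-elim (ℤ.<⇒≱ h<d (ℤ.≤-trans (ℤ.+≤+ d≤W+a) W+a≤h))
      where
      d≤W+a : d ≤ r * D + (k ∸ r) * d + a
      d≤W+a = ℕ.≤-trans (ℕ.m≤n*m d (k ∸ r) ⦃ ℕ.>-nonZero (ℕ.m<n⇒0<n∸m r<k) ⦄)
                        (ℕ.≤-trans (ℕ.m≤n+m _ (r * D)) (ℕ.m≤m+n _ a))
    bound-if-r<k r<k (inj₂ kd≤W+a) = bound-from-degrees (ℕ.<⇒≤ r<k) kd≤W+a

    bound-if-r≡k : ∀ {r} → r ≡ k →
                   + (r * D + (k ∸ r) * d + a) ℤ.≤ h ⊎ k * d ≤ r * D + (k ∸ r) * d + a →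
                   (+ (2 * k * d) ℤ.- + n ℤ.≤ + (k * D)) ⊎ (+ (k * D) ℤ.≤ h ℤ.+ + (k * d) ℤ.- + n)
    bound-if-r≡k ≡.refl (inj₁ W+a≤h) =
      inj₂ (≡.subst (λ m → + (k * D) ℤ.≤ h ℤ.+ + (k * d) ℤ.- + m) kd+a≡n
             (+≤⇒≤-+ (≡.subst (λ m → + m ℤ.≤ h) W≡kD+a W+a≤h)))
      where
      W≡kD+a : k * D + (k ∸ k) * d + a ≡ k * D + a
      W≡kD+a = ≡.cong (λ x → x + a)
                 (≡.trans (≡.cong (λ x → k * D + x * d) (ℕ.n∸n≡0 k)) (ℕ.+-identityʳ (k * D)))
    bound-if-r≡k ≡.refl (inj₂ kd≤W+a) =
      inj₁ (≡.subst (λ m → + (m * d) ℤ.- + n ℤ.≤ + (k * D))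
                    (≡.cong (λ x → k + x) (≡.sym (ℕ.+-identityʳ k)))
                    (bound-from-degrees ℕ.≤-refl kd≤W+a))

open Arithmetic

module PowerSeries {c ℓ} (R : CommutativeRing c ℓ) where
  open CommutativeRing R
  import Algebra.Construct.Pointwise ℕ as Pointwise
  open import Algebra.Properties.Ring ring using (-‿distribʳ-*; -‿+-comm; -0#≈0#)
  open import Algebra.Properties.Semiring.Mult semiring using (_×_; ×-congʳ; ×-assoc-*)
  open import Algebra.Properties.Semiring.Exp semiring using (_^_)
  open import Algebra.Solver.Ring.NaturalCoefficients.Default commutativeSemiring
  open import Relation.Binary.Reasoning.Setoid setoid

  Series : Set c
  Series = ℕ → Carrier

  infix  4 _≐_
  infixl 6 _+ₛ_
  infixl 7 _*ₛ_
  infix  8 -ₛ_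

  _≐_ : Series → Series → Set ℓ
  f ≐ g = ∀ i → f i ≈ g i

  _+ₛ_ : Series → Series → Series
  (f +ₛ g) i = f i + g i

  -ₛ_ : Series → Series
  (-ₛ f) i = - f i

  0ₛ : Series
  0ₛ _ = 0#

  1ₛ : Series
  1ₛ zero    = 1#
  1ₛ (suc _) = 0#

  shift : Series → Series
  shift f = f ∘ suc

  _*ₛ_ : Series → Series → Series
  (f *ₛ g) zero    = f 0 * g 0
  (f *ₛ g) (suc i) = f 0 * g (suc i) + (shift f *ₛ g) i

  *ₛ-cong : ∀ {f f′ g g′} → f ≐ f′ → g ≐ g′ → f *ₛ g ≐ f′ *ₛ g′
  *ₛ-cong f≐f′ g≐g′ zero    = *-cong (f≐f′ 0) (g≐g′ 0)
  *ₛ-cong f≐f′ g≐g′ (suc i) =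
    +-cong (*-cong (f≐f′ 0) (g≐g′ (suc i))) (*ₛ-cong (f≐f′ ∘ suc) g≐g′ i)

  *ₛ-zeroˡ : ∀ {f} g → f ≐ 0ₛ → f *ₛ g ≐ 0ₛ
  *ₛ-zeroˡ g f≐0 zero    = trans (*-congʳ (f≐0 0)) (zeroˡ _)
  *ₛ-zeroˡ g f≐0 (suc i) =
    trans (+-cong (trans (*-congʳ (f≐0 0)) (zeroˡ _)) (*ₛ-zeroˡ g (f≐0 ∘ suc) i)) (+-identityʳ 0#)

  *ₛ-identityˡ : ∀ g → 1ₛ *ₛ g ≐ g
  *ₛ-identityˡ g zero    = *-identityˡ _
  *ₛ-identityˡ g (suc i) =
    trans (+-cong (*-identityˡ _) (*ₛ-zeroˡ g (λ _ → refl) i)) (+-identityʳ _)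

  *ₛ-distribʳ : ∀ h f g → (f +ₛ g) *ₛ h ≐ f *ₛ h +ₛ g *ₛ h
  *ₛ-distribʳ h f g zero    = distribʳ _ _ _
  *ₛ-distribʳ h f g (suc i) = begin
    (f 0 + g 0) * h (suc i) + ((shift f +ₛ shift g) *ₛ h) i
      ≈⟨ +-cong (distribʳ _ _ _) (*ₛ-distribʳ h (shift f) (shift g) i) ⟩
    (f 0 * h (suc i) + g 0 * h (suc i)) + ((shift f *ₛ h) i + (shift g *ₛ h) i)
      ≈⟨ solve 4 (λ a b c d → (a :+ b) :+ (c :+ d) := (a :+ c) :+ (b :+ d)) refl _ _ _ _ ⟩
    (f 0 * h (suc i) + (shift f *ₛ h) i) + (g 0 * h (suc i) + (shift g *ₛ h) i) ∎

  *ₛ-scaleˡ : ∀ a f g → (λ i → a * f i) *ₛ g ≐ λ i → a * (f *ₛ g) i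
  *ₛ-scaleˡ a f g zero    = *-assoc _ _ _
  *ₛ-scaleˡ a f g (suc i) = begin
    a * f 0 * g (suc i) + ((λ j → a * shift f j) *ₛ g) i
      ≈⟨ +-cong (*-assoc _ _ _) (*ₛ-scaleˡ a (shift f) g i) ⟩
    a * (f 0 * g (suc i)) + a * (shift f *ₛ g) i ≈⟨ distribˡ _ _ _ ⟨
    a * (f 0 * g (suc i) + (shift f *ₛ g) i)     ∎

  *ₛ-unfoldʳ : ∀ f g i → (f *ₛ g) (suc i) ≈ (f *ₛ shift g) i + f (suc i) * g 0
  *ₛ-unfoldʳ f g zero    = refl
  *ₛ-unfoldʳ f g (suc i) = begin
    f 0 * g (suc (suc i)) + (shift f *ₛ g) (suc i)
      ≈⟨ +-congˡ (*ₛ-unfoldʳ (shift f) g i) ⟩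
    f 0 * g (suc (suc i)) + ((shift f *ₛ shift g) i + f (suc (suc i)) * g 0)
      ≈⟨ +-assoc _ _ _ ⟨
    f 0 * g (suc (suc i)) + (shift f *ₛ shift g) i + f (suc (suc i)) * g 0 ∎

  *ₛ-comm : ∀ f g → f *ₛ g ≐ g *ₛ f
  *ₛ-comm f g zero    = *-comm _ _
  *ₛ-comm f g (suc i) = begin
    f 0 * g (suc i) + (shift f *ₛ g) i ≈⟨ +-cong (*-comm _ _) (*ₛ-comm (shift f) g i) ⟩
    g (suc i) * f 0 + (g *ₛ shift f) i ≈⟨ +-comm _ _ ⟩
    (g *ₛ shift f) i + g (suc i) * f 0 ≈⟨ *ₛ-unfoldʳ g f i ⟨
    (g *ₛ f) (suc i)                   ∎

  *ₛ-assoc : ∀ f g h → (f *ₛ g) *ₛ h ≐ f *ₛ (g *ₛ h)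
  *ₛ-assoc f g h zero    = *-assoc _ _ _
  *ₛ-assoc f g h (suc i) = begin
    f 0 * g 0 * h (suc i) + (shift (f *ₛ g) *ₛ h) i
      ≈⟨ +-congˡ (*ₛ-distribʳ h (λ j → f 0 * g (suc j)) (shift f *ₛ g) i) ⟩
    f 0 * g 0 * h (suc i) + (((λ j → f 0 * shift g j) *ₛ h) i + ((shift f *ₛ g) *ₛ h) i)
      ≈⟨ +-congˡ (+-cong (*ₛ-scaleˡ (f 0) (shift g) h i) (*ₛ-assoc (shift f) g h i)) ⟩
    f 0 * g 0 * h (suc i) + (f 0 * (shift g *ₛ h) i + (shift f *ₛ (g *ₛ h)) i)
      ≈⟨ solve 5 (λ a b c d e → a :* b :* c :+ (a :* d :+ e) := a :* (b :* c :+ d) :+ e)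
                 refl _ _ _ _ _ ⟩
    f 0 * (g 0 * h (suc i) + (shift g *ₛ h) i) + (shift f *ₛ (g *ₛ h)) i ∎

  *ₛ-negʳ : ∀ f g → f *ₛ (-ₛ g) ≐ -ₛ (f *ₛ g)
  *ₛ-negʳ f g zero    = sym (-‿distribʳ-* _ _)
  *ₛ-negʳ f g (suc i) =
    trans (+-cong (sym (-‿distribʳ-* _ _)) (*ₛ-negʳ (shift f) g i)) (-‿+-comm _ _)

  series : CommutativeSemiring c ℓ
  series = record
    { Carrier = Series ; _≈_ = _≐_ ; _+_ = _+ₛ_ ; _*_ = _*ₛ_ ; 0# = 0ₛ ; 1# = 1ₛ
    ; isCommutativeSemiring = isCommutativeSemiringˡ record
      { +-isCommutativeMonoid = Pointwise.isCommutativeMonoid +-isCommutativeMonoid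
      ; *-isCommutativeMonoid = isCommutativeMonoidˡ record
        { isSemigroup = record
          { isMagma = record
            { isEquivalence = Pointwise.isEquivalence isEquivalence ; ∙-cong = *ₛ-cong }
          ; assoc   = *ₛ-assoc }
        ; identityˡ = *ₛ-identityˡ
        ; comm      = *ₛ-comm }
      ; distribʳ = *ₛ-distribʳ
      ; zeroˡ    = λ g → *ₛ-zeroˡ g (λ _ → refl) } }
    where open import Algebra.Structures.Biased _≐_ using (isCommutativeMonoidˡ; isCommutativeSemiringˡ)

  open CommutativeSemiring series using () renaming (semiring to seriesSemiring)
  open import Algebra.Properties.Semiring.Exp seriesSemiring using () renaming (_^_ to _^ₛ_)
  open import Algebra.Properties.Semiring.Mult seriesSemiring using () renaming (_×_ to _×ₛ_)
  open import Algebra.Properties.Semiring.Sum seriesSemiring using () renaming (sum to sumₛ)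

  -- f has degree at most a, with coefficient α in degree a (α may be 0).
  record Leading (f : Series) (a : ℕ) (α : Carrier) : Set ℓ where
    constructor leading
    field
      at    : f a ≈ α
      above : ∀ i → a ℕ.< i → f i ≈ 0#

  Leading-cong : ∀ {f g a α β} → f ≐ g → α ≈ β → Leading f a α → Leading g a β
  Leading-cong {a = a} f≐g α≈β (leading fa above) =
    leading (trans (sym (f≐g a)) (trans fa α≈β)) λ i a<i → trans (sym (f≐g i)) (above i a<i)

  Leading-zero : ∀ {f} a → f ≐ 0ₛ → Leading f a 0#
  Leading-zero a f≐0 = leading (f≐0 a) λ i _ → f≐0 i

  Leading-raise : ∀ {f a b α} → a ℕ.< b → Leading f a α → Leading f b 0#
  Leading-raise a<b (leading _ above) =
    leading (above _ a<b) λ i b<i → above i (ℕ.<-trans a<b b<i)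

  Leading-unshift : ∀ {f a α} → Leading (shift f) a α → Leading f (suc a) α
  Leading-unshift (leading fa above) = leading fa λ { (suc i) (s≤s a<i) → above i a<i }

  Leading-shift : ∀ {f a α} → Leading f (suc a) α → Leading (shift f) a α
  Leading-shift (leading fa above) = leading fa λ i a<i → above (suc i) (s≤s a<i)

  Leading-+ₛ : ∀ {f g a α β} → Leading f a α → Leading g a β → Leading (f +ₛ g) a (α + β)
  Leading-+ₛ (leading fa f-above) (leading ga g-above) =
    leading (+-cong fa ga) λ i a<i → trans (+-cong (f-above i a<i) (g-above i a<i)) (+-identityʳ 0#)

  Leading-+ₛ-< : ∀ {f g a b α β} → a ℕ.< b → Leading f a α → Leading g b β → Leading (f +ₛ g) b β
  Leading-+ₛ-< a<b lf lg =
    Leading-cong (λ _ → refl) (+-identityˡ _) (Leading-+ₛ (Leading-raise a<b lf) lg)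

  Leading-negₛ : ∀ {f a α} → Leading f a α → Leading (-ₛ f) a (- α)
  Leading-negₛ (leading fa above) =
    leading (-‿cong fa) λ i a<i → trans (-‿cong (above i a<i)) -0#≈0#

  Leading-scale : ∀ {f a α} c → Leading f a α → Leading (λ i → c * f i) a (c * α)
  Leading-scale c (leading fa above) =
    leading (*-congˡ fa) λ i a<i → trans (*-congˡ (above i a<i)) (zeroʳ c)

  Leading-*ₛ : ∀ {f g a b α β} → Leading f a α → Leading g b β → Leading (f *ₛ g) (a ℕ.+ b) (α * β)
  Leading-*ₛ {f} {g} {zero} (leading f0 f-above) lg =
    Leading-cong (λ i → sym (*ₛ-constantˡ i)) (*-congʳ f0) (Leading-scale (f 0) lg)
    where
    *ₛ-constantˡ : f *ₛ g ≐ λ i → f 0 * g i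
    *ₛ-constantˡ zero    = refl
    *ₛ-constantˡ (suc i) =
      trans (+-congˡ (*ₛ-zeroˡ g (λ j → f-above (suc j) (s≤s z≤n)) i)) (+-identityʳ _)
  Leading-*ₛ {f} {g} {suc a} {b} lf lg@(leading _ g-above) =
    Leading-unshift (Leading-cong (λ _ → refl) (+-identityˡ _)
      (Leading-+ₛ (Leading-cong (λ _ → refl) (zeroʳ (f 0)) (Leading-scale (f 0) shift-g-vanishes))
                  (Leading-*ₛ (Leading-shift lf) lg)))
    where
    b<1+a+b : ∀ {i} → a ℕ.+ b ℕ.≤ i → b ℕ.< suc i
    b<1+a+b a+b≤i = s≤s (ℕ.≤-trans (ℕ.m≤n+m b a) a+b≤i)
    shift-g-vanishes : Leading (shift g) (a ℕ.+ b) 0#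
    shift-g-vanishes =
      leading (g-above _ (b<1+a+b ℕ.≤-refl)) λ i a+b<i → g-above (suc i) (b<1+a+b (ℕ.<⇒≤ a+b<i))

  Leading-^ₛ : ∀ {f a α} → Leading f a α → ∀ n → Leading (f ^ₛ n) (n ℕ.* a) (α ^ n)
  Leading-^ₛ lf zero    = leading refl λ { (suc i) _ → refl }
  Leading-^ₛ lf (suc n) = Leading-*ₛ lf (Leading-^ₛ lf n)

  Leading-×ₛ : ∀ {f a α} → Leading f a α → ∀ m → Leading (m ×ₛ f) a (m × α)
  Leading-×ₛ {a = a} lf zero    = Leading-zero a (λ _ → refl)
  Leading-×ₛ         lf (suc m) = Leading-+ₛ lf (Leading-×ₛ lf m)

  Leading-sumₛ-zero : ∀ {n a} (t : Fin n → Series) → (∀ i → Leading (t i) a 0#) → Leading (sumₛ t) a 0#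
  Leading-sumₛ-zero {zero}  {a} t lt = Leading-zero a (λ _ → refl)
  Leading-sumₛ-zero {suc n}     t lt = Leading-cong (λ _ → refl) (+-identityʳ 0#)
    (Leading-+ₛ (lt Fin.zero) (Leading-sumₛ-zero (t ∘ Fin.suc) (lt ∘ Fin.suc)))

  Leading-sumₛ-single : ∀ {n a α} (t : Fin n → Series) ρ →
    Leading (t ρ) a α → (∀ i → i ≢ ρ → Leading (t i) a 0#) → Leading (sumₛ t) a α
  Leading-sumₛ-single t Fin.zero lρ others =
    Leading-cong (λ _ → refl) (+-identityʳ _)
      (Leading-+ₛ lρ (Leading-sumₛ-zero (t ∘ Fin.suc) (λ i → others (Fin.suc i) λ ())))
  Leading-sumₛ-single t (Fin.suc ρ) lρ others =
    Leading-cong (λ _ → refl) (+-identityˡ _)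
      (Leading-+ₛ (others Fin.zero λ ())
        (Leading-sumₛ-single (t ∘ Fin.suc) ρ lρ
          (λ i i≢ρ → others (Fin.suc i) (i≢ρ ∘ Fin.suc-injective))))

  ×≈×1* : ∀ m x → m × x ≈ (m × 1#) * x
  ×≈×1* m x = sym (trans (×-assoc-* m 1# x) (×-congʳ m (*-identityˡ x)))

  ×ₛ-vanishes : ∀ m f → m × 1# ≈ 0# → m ×ₛ f ≐ 0ₛ
  ×ₛ-vanishes m f m≈0 i =
    trans (×ₛ-pointwise m i) (trans (×≈×1* m (f i)) (trans (*-congʳ m≈0) (zeroˡ _)))
    where
    ×ₛ-pointwise : ∀ m i → (m ×ₛ f) i ≈ m × f i
    ×ₛ-pointwise zero    i = refl
    ×ₛ-pointwise (suc m) i = +-congˡ (×ₛ-pointwise m i)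

  module BinomialExpansion (E H : Series) where
    open import Algebra.Properties.Semiring.Binomial seriesSemiring E H using (binomialTerm; theorem)

    rest : ℕ → Series
    rest k = sumₛ (binomialTerm k ∘ Fin.suc)

    ^ₛ-expand : ∀ k → (E +ₛ H) ^ₛ k ≐ H ^ₛ k +ₛ rest k
    ^ₛ-expand k i =
      trans (theorem (*ₛ-comm E H) k i) (+-congʳ (trans (+-identityʳ _) (*ₛ-identityˡ (H ^ₛ k) i)))

    module _ {D d ε η} (lE : Leading E D ε) (lH : Leading H d η) (k : ℕ) where

      degree : ℕ → ℕ
      degree s = s ℕ.* D ℕ.+ (k ℕ.∸ s) ℕ.* d

      coefficient : ℕ → Carrier
      coefficient s = (k C s) × (ε ^ s * η ^ (k ℕ.∸ s))

      Leading-binomialTerm : ∀ s → Leading (binomialTerm k s) (degree (toℕ s)) (coefficient (toℕ s))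
      Leading-binomialTerm s =
        Leading-×ₛ (Leading-*ₛ (Leading-^ₛ lE (toℕ s)) (Leading-^ₛ lH (k ℕ.∸ toℕ s))) (k C toℕ s)

      -- Terms with s < r are killed by their coefficient, those with s > r have lower degree.
      Leading-rest : ∀ {r} → D ℕ.< d → 1 ℕ.≤ r → r ℕ.≤ k →
                     (∀ s → 1 ℕ.≤ s → s ℕ.< r → (k C s) × 1# ≈ 0#) →
                     Leading (rest k) (degree r) (coefficient r)
      Leading-rest {suc r′} D<d _ r≤k below-r-vanishes =
        Leading-sumₛ-single (binomialTerm k ∘ Fin.suc) ρ leading-ρ others
        where
        ρ : Fin k
        ρ = fromℕ< r≤k
        leading-ρ : Leading (binomialTerm k (Fin.suc ρ)) (degree (suc r′)) (coefficient (suc r′))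
        leading-ρ = ≡.subst (λ s → Leading (binomialTerm k (Fin.suc ρ)) (degree s) (coefficient s))
                            (≡.cong suc (Fin.toℕ-fromℕ< r≤k)) (Leading-binomialTerm (Fin.suc ρ))
        others : ∀ i → i ≢ ρ → Leading (binomialTerm k (Fin.suc i)) (degree (suc r′)) 0#
        others i i≢ρ with ℕ.<-cmp (toℕ i) r′
        ... | tri< i<r′ _ _ = Leading-zero _ (×ₛ-vanishes (k C suc (toℕ i)) _
                                (below-r-vanishes (suc (toℕ i)) (s≤s z≤n) (s≤s i<r′)))
        ... | tri≈ _ i≡r′ _ =
          ⊥-elim (i≢ρ (Fin.toℕ-injective (≡.trans i≡r′ (≡.sym (Fin.toℕ-fromℕ< r≤k)))))
        ... | tri> _ _ r′<i = Leading-raise (binomial-degree-decreasing D<d (s≤s r′<i) (Fin.toℕ<n i))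
                                            (Leading-binomialTerm (Fin.suc i))

  *ₛ-difference : ∀ f g α β → (f +ₛ g) *ₛ α +ₛ -ₛ (f *ₛ β) ≐ f *ₛ (α +ₛ -ₛ β) +ₛ g *ₛ α
  *ₛ-difference f g α β i = begin
    ((f +ₛ g) *ₛ α) i + - (f *ₛ β) i            ≈⟨ +-congʳ (*ₛ-distribʳ α f g i) ⟩
    (f *ₛ α) i + (g *ₛ α) i + - (f *ₛ β) i      ≈⟨ +-assoc _ _ _ ⟩
    (f *ₛ α) i + ((g *ₛ α) i + - (f *ₛ β) i)    ≈⟨ +-congˡ (+-comm _ _) ⟩
    (f *ₛ α) i + (- (f *ₛ β) i + (g *ₛ α) i)    ≈⟨ +-assoc _ _ _ ⟨
    (f *ₛ α) i + - (f *ₛ β) i + (g *ₛ α) i      ≈⟨ +-congʳ (+-congˡ (*ₛ-negʳ f β i)) ⟨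
    (f *ₛ α) i + (f *ₛ (-ₛ β)) i + (g *ₛ α) i
      ≈⟨ +-congʳ (CommutativeSemiring.distribˡ series f α (-ₛ β) i) ⟨
    (f *ₛ (α +ₛ -ₛ β)) i + (g *ₛ α) i           ∎

  VanishesAbove : ℤ → Series → Set ℓ
  VanishesAbove h f = ∀ i → h ℤ.< + i → f i ≈ 0#

  Leading⇒≤ : ∀ {f a α h} → Leading f a α → ¬ α ≈ 0# → VanishesAbove h f → + a ℤ.≤ h
  Leading⇒≤ {a = a} {h = h} (leading fa _) α≉0 f-vanishes with h ℤ.<? + a
  ... | yes h<a = ⊥-elim (α≉0 (trans (sym fa) (f-vanishes a h<a)))
  ... | no  h≮a = ℤ.≮⇒≥ h≮a

  Leading-cancel : ∀ {f g a b α β h} → Leading f a α → ¬ α ≈ 0# → Leading g b β → ¬ β ≈ 0# →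
                   VanishesAbove h (f +ₛ g) → a ≡ b ⊎ + (a ℕ.⊔ b) ℤ.≤ h
  Leading-cancel {a = a} {b} lf α≉0 lg β≉0 f+g-vanishes with ℕ.<-cmp a b
  ... | tri≈ _ a≡b _ = inj₁ a≡b
  ... | tri< a<b _ _ = inj₂ (≡.subst (λ x → + x ℤ.≤ _) (≡.sym (ℕ.m≤n⇒m⊔n≡n (ℕ.<⇒≤ a<b)))
                              (Leading⇒≤ (Leading-+ₛ-< a<b lf lg) β≉0 f+g-vanishes))
  ... | tri> _ _ b<a = inj₂ (≡.subst (λ x → + x ℤ.≤ _) (≡.sym (ℕ.m≥n⇒m⊔n≡m (ℕ.<⇒≤ b<a)))
                              (Leading⇒≤ (Leading-+ₛ-< b<a lg lf) α≉0
                                         (λ i h<i → trans (+-comm _ _) (f+g-vanishes i h<i))))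

module Polynomials {q} (𝔽 : FiniteField q) where
  open Poly 𝔽
  open PowerSeries cring
  open CommutativeSemiring series using () renaming (semiring to seriesSemiring)
  open import Algebra.Properties.Semiring.Exp seriesSemiring using (^-congˡ) renaming (_^_ to _^ₛ_)
  open import Algebra.Properties.Semiring.Exp semiring using (_^_)
  open import Algebra.Properties.Semiring.Mult semiring using (_×_; ×1-homo-*)
  open import Algebra.Properties.Ring ring
    using (-‿involutive; -0#≈0#; x∙y⁻¹≈ε⇒x≈y; x≈y⇒x∙y⁻¹≈ε)
  open import Algebra.Solver.Ring.NaturalCoefficients.Default commutativeSemiring
  open import Relation.Binary.Reasoning.Setoid setoid

  coeff-⊕ : ∀ P Q → coeff (P ⊕ Q) ≐ coeff P +ₛ coeff Q
  coeff-⊕ []      Q       i       = sym (+-identityˡ _)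
  coeff-⊕ (a ∷ P) []      i       = sym (+-identityʳ _)
  coeff-⊕ (a ∷ P) (b ∷ Q) zero    = refl
  coeff-⊕ (a ∷ P) (b ∷ Q) (suc i) = coeff-⊕ P Q i

  coeff-neg : ∀ P → coeff (neg P) ≐ -ₛ coeff P
  coeff-neg []      i       = sym -0#≈0#
  coeff-neg (a ∷ P) zero    = refl
  coeff-neg (a ∷ P) (suc i) = coeff-neg P i

  coeff-⊖ : ∀ P Q → coeff (P ⊖ Q) ≐ coeff P +ₛ -ₛ coeff Q
  coeff-⊖ P Q i = trans (coeff-⊕ P (neg Q) i) (+-congˡ (coeff-neg Q i))

  coeff-scale : ∀ a P → coeff (scale a P) ≐ λ i → a * coeff P i
  coeff-scale a []      i       = sym (zeroʳ a)
  coeff-scale a (b ∷ P) zero    = refl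
  coeff-scale a (b ∷ P) (suc i) = coeff-scale a P i

  coeff-⊗ : ∀ P Q → coeff (P ⊗ Q) ≐ coeff P *ₛ coeff Q
  coeff-⊗ []      Q i       = sym (*ₛ-zeroˡ (coeff Q) (λ _ → refl) i)
  coeff-⊗ (a ∷ P) Q zero    =
    trans (coeff-⊕ (scale a Q) _ 0) (trans (+-identityʳ _) (coeff-scale a Q 0))
  coeff-⊗ (a ∷ P) Q (suc i) =
    trans (coeff-⊕ (scale a Q) _ (suc i)) (+-cong (coeff-scale a Q (suc i)) (coeff-⊗ P Q i))

  coeff-^^ : ∀ P n → coeff (P ^^ n) ≐ coeff P ^ₛ n
  coeff-^^ P zero    zero    = refl
  coeff-^^ P zero    (suc i) = refl
  coeff-^^ P (suc n) i       = trans (coeff-⊗ P (P ^^ n) i) (*ₛ-cong (λ _ → refl) (coeff-^^ P n) i)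

  MonicDeg⇒Leading : ∀ P {d} → MonicDeg P d → Leading (coeff P) d 1#
  MonicDeg⇒Leading P ((_ , above) , monic) = leading monic above

  HasDeg⇒Leading : ∀ P {d} → HasDeg P d → Leading (coeff P) d (coeff P d)
  HasDeg⇒Leading P (_ , above) = leading refl above

  zero⊎HasDeg : ∀ P → coeff P ≐ 0ₛ ⊎ ∃ (HasDeg P)
  zero⊎HasDeg []      = inj₁ (λ _ → refl)
  zero⊎HasDeg (a ∷ P) with zero⊎HasDeg P
  ... | inj₂ (m , nz , above) = inj₂ (suc m , nz , λ { (suc i) (s≤s m<i) → above i m<i })
  ... | inj₁ P≐0 with a ≟ 0#
  ...   | yes a≈0 = inj₁ λ { zero → a≈0 ; (suc i) → P≐0 i }
  ...   | no  a≉0 = inj₂ (0 , a≉0 , λ { (suc i) _ → P≐0 i })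

  monic-difference-degree< : ∀ G H {d D} → MonicDeg G d → MonicDeg H d → HasDeg (G ⊖ H) D → D ℕ.< d
  monic-difference-degree< G H {d} {D} ((_ , G-above) , G-monic) ((_ , H-above) , H-monic) (G-H≉0 , _)
    with D ℕ.<? d
  ... | yes D<d = D<d
  ... | no  D≮d = ⊥-elim (G-H≉0 (trans (coeff-⊖ G H D) (x≈y⇒x∙y⁻¹≈ε G≈H)))
    where
    G≈H : coeff G D ≈ coeff H D
    G≈H with ℕ.m≤n⇒m<n∨m≡n (ℕ.≮⇒≥ D≮d)
    ... | inj₁ d<D    = trans (G-above D d<D) (sym (H-above D d<D))
    ... | inj₂ ≡.refl = trans G-monic (sym H-monic)

  *-nonzero : ∀ {x y} → ¬ x ≈ 0# → ¬ y ≈ 0# → ¬ x * y ≈ 0#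
  *-nonzero {x} {y} x≉0 y≉0 xy≈0 with inverse x x≉0
  ... | x⁻¹ , xx⁻¹≈1 = y≉0 (begin
    y               ≈⟨ *-identityˡ y ⟨
    1# * y          ≈⟨ *-congʳ xx⁻¹≈1 ⟨
    x * x⁻¹ * y     ≈⟨ solve 3 (λ x x⁻¹ y → x :* x⁻¹ :* y := x⁻¹ :* (x :* y)) refl x x⁻¹ y ⟩
    x⁻¹ * (x * y)   ≈⟨ *-congˡ xy≈0 ⟩
    x⁻¹ * 0#        ≈⟨ zeroʳ x⁻¹ ⟩
    0#              ∎)

  ^-nonzero : ∀ {x} n → ¬ x ≈ 0# → ¬ x ^ n ≈ 0#
  ^-nonzero zero    x≉0 = 1≉0
  ^-nonzero (suc n) x≉0 = *-nonzero x≉0 (^-nonzero n x≉0)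

  -‿nonzero : ∀ {x} → ¬ x ≈ 0# → ¬ - x ≈ 0#
  -‿nonzero {x} x≉0 -x≈0 = x≉0 (trans (sym (-‿involutive x)) (trans (-‿cong -x≈0) -0#≈0#))

  ·1≈×1 : ∀ n → n ·1 ≈ n × 1#
  ·1≈×1 zero    = refl
  ·1≈×1 (suc n) = +-congˡ (·1≈×1 n)

  ×1-multiple : ∀ {n} t → n × 1# ≈ 0# → (t ℕ.* n) × 1# ≈ 0#
  ×1-multiple {n} t n≈0 = trans (×1-homo-* t n) (trans (*-congˡ n≈0) (zeroʳ _))

  module Characteristic {p} (prime : Prime p) (p≈0 : p × 1# ≈ 0#) where

    ∣⇒×1≈0 : ∀ {m} → p ∣ m → m × 1# ≈ 0#
    ∣⇒×1≈0 (divides t ≡.refl) = ×1-multiple t p≈0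

    1+zero≉zero : ∀ {u v} → u × 1# ≈ 0# → v × 1# ≈ 0# → suc u ≢ v
    1+zero≉zero {u} u≈0 v≈0 ≡.refl = 1≉0 (begin
      1#            ≈⟨ +-identityʳ 1# ⟨
      1# + 0#       ≈⟨ +-congˡ u≈0 ⟨
      suc u × 1#    ≈⟨ v≈0 ⟩
      0#            ∎)

    -- Bézout: 1 + y m = x p (or the other way round), and both multiples vanish.
    ∤⇒×1≉0 : ∀ {m} → ¬ p ∣ m → ¬ m × 1# ≈ 0#
    ∤⇒×1≉0 {m} p∤m m≈0 with coprime-Bézout coprime
      where
      coprime : Coprime p m
      coprime (d∣p , d∣m) with prime⇒irreducible prime d∣p
      ... | inj₁ d≡1    = d≡1
      ... | inj₂ ≡.refl = ⊥-elim (p∤m d∣m)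
    ... | Bézout.+- x y eq = 1+zero≉zero (×1-multiple y m≈0) (×1-multiple x p≈0) eq
    ... | Bézout.-+ x y eq = 1+zero≉zero (×1-multiple x p≈0) (×1-multiple y m≈0) eq

  InI-difference : ∀ F {h} P Q → InI F h P → InI F h Q → VanishesAbove h (coeff P +ₛ -ₛ coeff Q)
  InI-difference F P Q F-P-vanishes F-Q-vanishes i h<i =
    x≈y⇒x∙y⁻¹≈ε (trans (sym (F≈ P F-P-vanishes)) (F≈ Q F-Q-vanishes))
    where
    F≈ : ∀ R → InI F _ R → coeff F i ≈ coeff R i
    F≈ R F-R-vanishes = x∙y⁻¹≈ε⇒x≈y _ _ (trans (sym (coeff-⊖ F R i)) (F-R-vanishes i h<i))

  InI⇒degree≡ : ∀ F P {h n e γ} → MonicDeg F n → h ℤ.< + n →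
                Leading (coeff P) e γ → ¬ γ ≈ 0# → InI F h P → e ≡ n
  InI⇒degree≡ F P {e = e} F-monic h<n lP γ≉0 F-P-vanishes
    with Leading-cancel (MonicDeg⇒Leading F F-monic) 1≉0 (Leading-negₛ lP) (-‿nonzero γ≉0)
                        (λ i h<i → trans (sym (coeff-⊖ F P i)) (F-P-vanishes i h<i))
  ... | inj₁ n≡e   = ≡.sym n≡e
  ... | inj₂ n⊔e≤h = ⊥-elim (ℤ.<⇒≱ h<n (ℤ.≤-trans (ℤ.+≤+ (ℕ.m≤m⊔n _ e)) n⊔e≤h))

  Leading-^^-⊗ : ∀ G A k {d a} → MonicDeg G d → MonicDeg A a →
                 Leading (coeff ((G ^^ k) ⊗ A)) (k ℕ.* d ℕ.+ a) (1# ^ k * 1#)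
  Leading-^^-⊗ G A k G-monic A-monic =
    Leading-cong (λ i → sym (trans (coeff-⊗ (G ^^ k) A i) (*ₛ-cong (coeff-^^ G k) (λ _ → refl) i)))
                 refl
      (Leading-*ₛ (Leading-^ₛ (MonicDeg⇒Leading G G-monic) k) (MonicDeg⇒Leading A A-monic))

  cofactor-degree : ∀ F G A k {h n d a} → MonicDeg F n → h ℤ.< + n → MonicDeg G d → MonicDeg A a →
                    InI F h ((G ^^ k) ⊗ A) → k ℕ.* d ℕ.+ a ≡ n
  cofactor-degree F G A k F-monic h<n G-monic A-monic =
    InI⇒degree≡ F ((G ^^ k) ⊗ A) F-monic h<n (Leading-^^-⊗ G A k G-monic A-monic)
                (*-nonzero (^-nonzero k 1≉0) 1≉0)

  module _ (F G H A B : Pol) {h : ℤ} {k d a D : ℕ}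
           (G-monic : MonicDeg G d) (H-monic : MonicDeg H d) (A-monic : MonicDeg A a)
           (GA∈I : InI F h ((G ^^ k) ⊗ A)) (HB∈I : InI F h ((H ^^ k) ⊗ B))
           (G-H-degree : HasDeg (G ⊖ H) D) where

    open BinomialExpansion (coeff (G ⊖ H)) (coeff H)

    coeff-G^^k : coeff (G ^^ k) ≐ coeff H ^ₛ k +ₛ rest k
    coeff-G^^k i = trans (coeff-^^ G k i) (trans (^-congˡ k G≐[G-H]+H i) (^ₛ-expand k i))
      where
      G≐[G-H]+H : coeff G ≐ coeff (G ⊖ H) +ₛ coeff H
      G≐[G-H]+H i = begin
        coeff G i                               ≈⟨ +-identityʳ _ ⟨
        coeff G i + 0#                          ≈⟨ +-congˡ (-‿inverseˡ _) ⟨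
        coeff G i + (- coeff H i + coeff H i)   ≈⟨ +-assoc _ _ _ ⟨
        coeff G i + - coeff H i + coeff H i     ≈⟨ +-congʳ (coeff-⊖ G H i) ⟨
        coeff (G ⊖ H) i + coeff H i             ∎

    -- G^k A - H^k B = H^k (A - B) + (G^k - H^k) A, and the left side has degree at most h.
    cancellation : VanishesAbove h (coeff H ^ₛ k *ₛ coeff (A ⊖ B) +ₛ rest k *ₛ coeff A)
    cancellation i h<i = begin
      (coeff H ^ₛ k *ₛ coeff (A ⊖ B) +ₛ rest k *ₛ coeff A) i
        ≈⟨ +-congʳ (*ₛ-cong {f = coeff H ^ₛ k} (λ _ → refl) (coeff-⊖ A B) i) ⟩
      (coeff H ^ₛ k *ₛ (coeff A +ₛ -ₛ coeff B) +ₛ rest k *ₛ coeff A) i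
        ≈⟨ *ₛ-difference (coeff H ^ₛ k) (rest k) (coeff A) (coeff B) i ⟨
      ((coeff H ^ₛ k +ₛ rest k) *ₛ coeff A +ₛ -ₛ (coeff H ^ₛ k *ₛ coeff B)) i
        ≈⟨ +-cong (trans (*ₛ-cong (sym ∘ coeff-G^^k) (λ _ → refl) i) (sym (coeff-⊗ (G ^^ k) A i)))
                  (-‿cong (trans (*ₛ-cong (sym ∘ coeff-^^ H k) (λ _ → refl) i)
                                 (sym (coeff-⊗ (H ^^ k) B i)))) ⟩
      coeff ((G ^^ k) ⊗ A) i + - coeff ((H ^^ k) ⊗ B) i
        ≈⟨ InI-difference F ((G ^^ k) ⊗ A) ((H ^^ k) ⊗ B) GA∈I HB∈I i h<i ⟩
      0# ∎

    degree-dichotomy : ∀ {r} → h ℤ.< + d → 1 ℕ.≤ r → r ℕ.≤ k →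
      (∀ s → 1 ℕ.≤ s → s ℕ.< r → (k C s) × 1# ≈ 0#) → ¬ (k C r) × 1# ≈ 0# →
      + (r ℕ.* D ℕ.+ (k ℕ.∸ r) ℕ.* d ℕ.+ a) ℤ.≤ h
      ⊎ k ℕ.* d ℕ.≤ r ℕ.* D ℕ.+ (k ℕ.∸ r) ℕ.* d ℕ.+ a
    degree-dichotomy {r} h<d 1≤r r≤k below-r-vanishes kCr≉0 = case zero⊎HasDeg (A ⊖ B) of λ where
        (inj₁ A-B≐0) → inj₁ (Leading⇒≤ rest-A-leads rest-A-lead≉0 λ i h<i → begin
          (rest k *ₛ coeff A) i                                      ≈⟨ +-identityˡ _ ⟨
          0# + (rest k *ₛ coeff A) i                                 ≈⟨ +-congʳ (H^k[A-B]≐0 A-B≐0 i) ⟨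
          (coeff H ^ₛ k *ₛ coeff (A ⊖ B) +ₛ rest k *ₛ coeff A) i     ≈⟨ cancellation i h<i ⟩
          0#                                                         ∎)
        (inj₂ (m , A-B-degree)) →
          case Leading-cancel (H^k[A-B]-leads A-B-degree) (H^k[A-B]-lead≉0 A-B-degree)
                              rest-A-leads rest-A-lead≉0 cancellation of λ where
            (inj₁ degrees≡) → inj₂ (≡.subst (k ℕ.* d ℕ.≤_) degrees≡ (ℕ.m≤m+n _ m))
            (inj₂ max≤h)    → ⊥-elim (ℤ.<⇒≱ h<d (ℤ.≤-trans (ℤ.+≤+ (d≤max m)) max≤h))
     where
      ε : Carrier
      ε = coeff (G ⊖ H) D

      lH : Leading (coeff H) d 1#
      lH = MonicDeg⇒Leading H H-monic

      rest-A-leads : Leading (rest k *ₛ coeff A) (r ℕ.* D ℕ.+ (k ℕ.∸ r) ℕ.* d ℕ.+ a)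
                             ((k C r) × (ε ^ r * 1# ^ (k ℕ.∸ r)) * 1#)
      rest-A-leads =
        Leading-*ₛ (Leading-rest (HasDeg⇒Leading (G ⊖ H) G-H-degree) lH k
                                 (monic-difference-degree< G H G-monic H-monic G-H-degree) 1≤r r≤k below-r-vanishes)
                   (MonicDeg⇒Leading A A-monic)

      rest-A-lead≉0 : ¬ (k C r) × (ε ^ r * 1# ^ (k ℕ.∸ r)) * 1# ≈ 0#
      rest-A-lead≉0 = *-nonzero (λ c≈0 → ε^r≉0 (trans (sym (×≈×1* (k C r) _)) c≈0)) 1≉0
        where
        ε^r≉0 : ¬ ((k C r) × 1#) * (ε ^ r * 1# ^ (k ℕ.∸ r)) ≈ 0#
        ε^r≉0 = *-nonzero kCr≉0 (*-nonzero (^-nonzero r (proj₁ G-H-degree)) (^-nonzero (k ℕ.∸ r) 1≉0))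

      H^k[A-B]≐0 : coeff (A ⊖ B) ≐ 0ₛ → coeff H ^ₛ k *ₛ coeff (A ⊖ B) ≐ 0ₛ
      H^k[A-B]≐0 A-B≐0 i = trans (*ₛ-comm _ _ i) (*ₛ-zeroˡ _ A-B≐0 i)

      H^k[A-B]-leads : ∀ {m} → HasDeg (A ⊖ B) m →
                       Leading (coeff H ^ₛ k *ₛ coeff (A ⊖ B)) (k ℕ.* d ℕ.+ m) (1# ^ k * coeff (A ⊖ B) m)
      H^k[A-B]-leads A-B-degree = Leading-*ₛ (Leading-^ₛ lH k) (HasDeg⇒Leading (A ⊖ B) A-B-degree)

      H^k[A-B]-lead≉0 : ∀ {m} → HasDeg (A ⊖ B) m → ¬ 1# ^ k * coeff (A ⊖ B) m ≈ 0#
      H^k[A-B]-lead≉0 (δ≉0 , _) = *-nonzero (^-nonzero k 1≉0) δ≉0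

      d≤max : ∀ m → d ℕ.≤ (k ℕ.* d ℕ.+ m) ℕ.⊔ (r ℕ.* D ℕ.+ (k ℕ.∸ r) ℕ.* d ℕ.+ a)
      d≤max m = ℕ.≤-trans (ℕ.m≤n*m d k ⦃ ℕ.>-nonZero (ℕ.≤-trans 1≤r r≤k) ⦄)
                          (ℕ.≤-trans (ℕ.m≤m+n _ m) (ℕ.m≤m⊔n _ _))

open import Data.Product using (_×_)

proposition5p1 : (q : ℕ) (𝔽 : FiniteField q) →
    let open Poly 𝔽 in
    (p : ℕ) → Prime p → (p ·1) ≈ 0# →
    (k n : ℕ) (h : ℤ) → 2 ℕ.≤ k →
    (F : Pol) → MonicDeg F n →
    (d : ℕ) → h ℤ.< + d → k ℕ.* d ℕ.≤ n →
    (r : ℕ) → 1 ℕ.≤ r → ¬ (p ∣ (k C r)) →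
    (∀ s → 1 ℕ.≤ s → s ℕ.< r → p ∣ (k C s)) →
    (G H : Pol) → InS F h k d G → InS F h k d H → ¬ (G ≋ H) →
    (D : ℕ) → HasDeg (G ⊖ H) D →
    (r ℕ.< k → + ((k ℕ.+ r) ℕ.* d) ℤ.- + n ℤ.≤ + (r ℕ.* D))
    × (r ≡ k →
         (+ (2 ℕ.* k ℕ.* d) ℤ.- + n ℤ.≤ + (k ℕ.* D))
         ⊎ (+ (k ℕ.* D) ℤ.≤ h ℤ.+ + (k ℕ.* d) ℤ.- + n))
proposition5p1 q 𝔽 p p-prime p≈0 k n h 2≤k F F-monic d h<d kd≤n r 1≤r p∤kCr p∣kCs G H
               (G-monic , A , (a , A-monic) , GA∈I) (H-monic , B , _ , HB∈I) _ D G-H-degree =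
  (λ r<k → bound-if-r<k h<d kd+a≡n r<k dichotomy) , (λ r≡k → bound-if-r≡k h<d kd+a≡n r≡k dichotomy)
  where
  open Poly 𝔽
  open Polynomials 𝔽
  open Characteristic p-prime (trans (sym (·1≈×1 p)) p≈0)
  r≤k : r ℕ.≤ k
  r≤k = ℕ.≮⇒≥ λ k<r → p∤kCr (≡.subst (p ∣_) (≡.sym (k>n⇒nCk≡0 k<r)) (p ∣0))
  h<n : h ℤ.< + n
  h<n = ℤ.<-≤-trans h<d
          (ℤ.+≤+ (ℕ.≤-trans (ℕ.m≤n*m d k ⦃ ℕ.>-nonZero (ℕ.≤-trans (s≤s z≤n) 2≤k) ⦄) kd≤n))
  kd+a≡n : k ℕ.* d ℕ.+ a ≡ n
  kd+a≡n = cofactor-degree F G A k F-monic h<n G-monic A-monic GA∈I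
  dichotomy : + (r ℕ.* D ℕ.+ (k ℕ.∸ r) ℕ.* d ℕ.+ a) ℤ.≤ h
              ⊎ k ℕ.* d ℕ.≤ r ℕ.* D ℕ.+ (k ℕ.∸ r) ℕ.* d ℕ.+ a
  dichotomy = degree-dichotomy F G H A B G-monic H-monic A-monic GA∈I HB∈I G-H-degree h<d 1≤r r≤k
                (λ s 1≤s s<r → ∣⇒×1≈0 (p∣kCs s 1≤s s<r)) (∤⇒×1≉0 p∤kCr)
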